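{- For $n\ge1$ and integers $m,k$ let $g_n(m,k)=\#\{t\in\mathfrak T_{2n+1}:\mathrm{eoc}(t)=m,\ \mathrm{pom}(t)=k\}$, $g_n(m,\bullet)=\sum_{k}g_n(m,k)$ and $g_n(\bullet,k)=\sum_m g_n(m,k)$. Then for every $n\ge2$: (1) $g_n(m,2n)=0$ for all $1\le m\le 2n$; $g_n(m,2n-1)=g_{n-1}(m,\bullet)$ for $1\le m\le 2n-2$; and $g_n(2n-1,2n-1)=g_n(2n,2n-1)=0$; (2) $g_n(2n,k)=g_{n-1}(k,\bullet)$ for $1\le k\le 2n-2$ and $g_n(2n,2n-1)=g_n(2n,2n)=0$; moreover $g_n(2n-1,k)=g_{n-1}(k,\bullet)+g_{n-1}(\bullet,k)$ for $1\le k\le 2n-2$ and $g_n(2n-1,2n-1)=g_n(2n-1,2n)=0$.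
   Context: A strictly ordered binary tree on $N$ vertices is a rooted tree whose vertices are labeled bijectively by $1,\dots,N$, the root being labeled $1$, in which every vertex has either no child (a leaf) or exactly two children (their order is immaterial), and labels increase along every path from the root. $\mathfrak T_{2n+1}$ denotes the set of these trees on $2n+1$ vertices. For $t\in\mathfrak T_{2n+1}$ ($n\ge1$): the minimal chain starts at the root and repeatedly moves to the child with the smaller label until a leaf is reached; $\mathrm{eoc}(t)$ is the label of that leaf. The vertex $2n+1$ is a leaf, and $\mathrm{pom}(t)$ is the label of its parent. -}

module Defs where

open import Data.Nat using (ℕ; zero; suc; _+_; _*_; _⊓_; _≟_)
open import Data.Nat.Properties using ()
open import Data.List using (List; []; _∷_; _∷ʳ_; map; concatMap; filter; length; upTo; zip; foldr; foldl)
open import Data.List.Relation.Unary.All using (All)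
open import Data.List.Relation.Unary.All using () renaming (all? to all?)
open import Data.Product using (_×_; _,_; proj₁; proj₂)
open import Data.Sum using (_⊎_)
open import Relation.Nullary using (Dec)
open import Relation.Nullary.Decidable using (_×-dec_; _⊎-dec_)
open import Relation.Binary.PropositionalEquality using (_≡_)

-- A rooted tree on vertex set {1,…,N} with root 1 in which labels increase
-- along every path is the same thing as its parent map: vertex i (2 ≤ i ≤ N)
-- has a parent pᵢ with 1 ≤ pᵢ < i.  We encode it by the list
--   ps = [p₂, p₃, …, p_N]   (length N-1, the j-th entry (0-based) is the
--                             parent of vertex j+2, and lies in {1,…,j+1}).
-- Children are unordered, so this encoding is a bijection with such trees.

parentLists : ℕ → List (List ℕ)
parentLists zero    = [] ∷ []
parentLists (suc j) =
  concatMap (λ s → map (λ p → s ∷ʳ p) (map suc (upTo (suc j)))) (parentLists j)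

labelled : List ℕ → List (ℕ × ℕ)
labelled ps = zip (map (λ j → 2 + j) (upTo (length ps))) ps

children : List ℕ → ℕ → List ℕ
children ps v = map proj₁ (filter (λ q → proj₂ q ≟ v) (labelled ps))

nChildren : List ℕ → ℕ → ℕ
nChildren ps v = length (children ps v)

vertices : ℕ → List ℕ
vertices N = map suc (upTo N)

IsBinary : ℕ → List ℕ → Set
IsBinary N ps = All (λ v → nChildren ps v ≡ 0 ⊎ nChildren ps v ≡ 2) (vertices N)

isBinary? : (N : ℕ) (ps : List ℕ) → Dec (IsBinary N ps)
isBinary? N ps = all? (λ v → (nChildren ps v ≟ 0) ⊎-dec (nChildren ps v ≟ 2)) (vertices N)

trees : ℕ → List (List ℕ)
trees zero    = []
trees (suc j) = filter (isBinary? (suc j)) (parentLists j)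

-- minimal chain: from v repeatedly move to the smaller child until a leaf.
-- (fuel suffices: labels strictly increase along the chain)
walk : List ℕ → ℕ → ℕ → ℕ
walk ps zero     v = v
walk ps (suc f)  v with children ps v
... | []     = v
... | c ∷ cs = walk ps f (foldr _⊓_ c cs)

eoc : List ℕ → ℕ
eoc ps = walk ps (suc (length ps)) 1

-- pom(t): parent of the vertex N (the last entry of the parent list)
pom : List ℕ → ℕ
pom ps = foldl (λ _ x → x) 0 ps

g : ℕ → ℕ → ℕ → ℕ
g n m k = length (filter (λ ps → (eoc ps ≟ m) ×-dec (pom ps ≟ k)) (trees (suc (2 * n))))

gEoc : ℕ → ℕ → ℕ
gEoc n m = length (filter (λ ps → eoc ps ≟ m) (trees (suc (2 * n))))

gPom : ℕ → ℕ → ℕ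
gPom n k = length (filter (λ ps → pom ps ≟ k) (trees (suc (2 * n))))

module Submission where

-- A tree on 1+L vertices is encoded by its parent list
-- [p₂,…,p_{L+1}]; appending p (written ps ∷ʳ p) attaches a new vertex, the
-- largest one, below p.  Everything in the theorem is controlled by how it
-- changes under one attachment:
--   * only p gains a child (nChildren-∷ʳ);
--   * the minimal chain ends at the new vertex if it ended at p before, and
--     is unchanged otherwise, because the new child is never the smallest
--     child of a vertex that already has one (eoc-∷ʳ);
--   * pom is simply the last parent (pom-∷ʳ).
-- A tree of 𝔗_{2n+1} is thus qs ∷ʳ a ∷ʳ b with qs a parent list on 2n-1
-- vertices, a the parent of 2n and b = pom.  We count with sums of 0/1
-- indicators over all parent lists.  For each identity the conditions on
-- eoc and pom pin the last parents (a and b, and for g_n(2n-1,k) also the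
-- parent of 2n-1), after which what remains is a binary tree on 2n-1
-- vertices: trees differing by a cherry (two leaves hung below a leaf) are
-- binary together (binary-cherry).

open import Defs
open import Data.Nat using (ℕ; zero; suc; pred; _+_; _*_; _∸_; _≤_; _<_; _⊓_; _≟_; _≤?_; z≤n; s≤s)
open import Data.Nat.Properties
open import Data.List using (List; []; _∷_; _∷ʳ_; _++_; map; concatMap; filter; length; upTo; zip; foldr)
open import Data.List.Properties
  using (length-++; length-map; length-upTo; ++-identityʳ; map-++; upTo-∷ʳ; foldr-∷ʳ; foldl-∷ʳ; filter-++; filter-accept; filter-reject; foldr-preservesᵇ)
open import Data.List.Relation.Unary.All using (All; []; _∷_)
import Data.List.Relation.Unary.All as All
open import Data.List.Relation.Unary.All.Properties using (map⁺; map⁻; applyUpTo⁺₁; applyUpTo⁻; ∷ʳ⁺)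
open import Data.Product using (Σ; _×_; _,_; proj₁; proj₂)
open import Data.Sum using (_⊎_; inj₁; inj₂; [_,_]′)
open import Data.Empty using (⊥; ⊥-elim)
open import Relation.Nullary using (Dec; yes; no; ¬_)
open import Relation.Nullary.Decidable using (_×-dec_)
open import Relation.Binary.PropositionalEquality
open import Function using (case_of_)
open import Algebra.Properties.CommutativeSemigroup +-commutativeSemigroup using (interchange)

⟦_⟧ : ∀ {P : Set} → Dec P → ℕ
⟦ yes _ ⟧ = 1
⟦ no  _ ⟧ = 0

⟦⟧-yes : ∀ {P : Set} (d : Dec P) → P → ⟦ d ⟧ ≡ 1
⟦⟧-yes (yes _) _ = refl
⟦⟧-yes (no ¬p) p = ⊥-elim (¬p p)

⟦⟧-no : ∀ {P : Set} (d : Dec P) → ¬ P → ⟦ d ⟧ ≡ 0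
⟦⟧-no (yes p) ¬p = ⊥-elim (¬p p)
⟦⟧-no (no _)  _  = refl

⟦⟧-cong : ∀ {P Q : Set} (p : Dec P) (q : Dec Q) → (P → Q) → (Q → P) → ⟦ p ⟧ ≡ ⟦ q ⟧
⟦⟧-cong (yes _) (yes _) _   _   = refl
⟦⟧-cong (yes p) (no ¬q) p→q _   = ⊥-elim (¬q (p→q p))
⟦⟧-cong (no ¬p) (yes q) _   q→p = ⊥-elim (¬p (q→p q))
⟦⟧-cong (no _)  (no _)  _   _   = refl

-- Attaching a vertex: effect on the children lists.

length-∷ʳ : ∀ {A : Set} (xs : List A) x → length (xs ∷ʳ x) ≡ suc (length xs)
length-∷ʳ xs x = trans (length-++ xs) (+-comm (length xs) 1)

zip-∷ʳ : ∀ {A B : Set} (xs : List A) (ys : List B) x y → length xs ≡ length ys →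
  zip (xs ∷ʳ x) (ys ∷ʳ y) ≡ zip xs ys ∷ʳ (x , y)
zip-∷ʳ []       []       x y _  = refl
zip-∷ʳ (a ∷ xs) (b ∷ ys) x y eq = cong ((a , b) ∷_) (zip-∷ʳ xs ys x y (suc-injective eq))

labelled-∷ʳ : ∀ ps p → labelled (ps ∷ʳ p) ≡ labelled ps ∷ʳ (2 + length ps , p)
labelled-∷ʳ ps p = begin
    zip (map (2 +_) (upTo (length (ps ∷ʳ p)))) (ps ∷ʳ p)
  ≡⟨ cong (λ l → zip (map (2 +_) (upTo l)) (ps ∷ʳ p)) (length-∷ʳ ps p) ⟩
    zip (map (2 +_) (upTo (suc (length ps)))) (ps ∷ʳ p)
  ≡⟨ cong (λ u → zip (map (2 +_) u) (ps ∷ʳ p)) (sym (upTo-∷ʳ (length ps))) ⟩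
    zip (map (2 +_) (upTo (length ps) ∷ʳ length ps)) (ps ∷ʳ p)
  ≡⟨ cong (λ u → zip u (ps ∷ʳ p)) (map-++ (2 +_) (upTo (length ps)) _) ⟩
    zip (map (2 +_) (upTo (length ps)) ∷ʳ (2 + length ps)) (ps ∷ʳ p)
  ≡⟨ zip-∷ʳ _ ps _ p (trans (length-map _ (upTo (length ps))) (length-upTo (length ps))) ⟩
    labelled ps ∷ʳ (2 + length ps , p) ∎
  where open ≡-Reasoning

children-∷ʳ : ∀ ps p v → children (ps ∷ʳ p) v ≡
  children ps v ++ map proj₁ (filter (λ q → proj₂ q ≟ v) ((2 + length ps , p) ∷ []))
children-∷ʳ ps p v = begin
    map proj₁ (filter (λ q → proj₂ q ≟ v) (labelled (ps ∷ʳ p)))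
  ≡⟨ cong (λ l → map proj₁ (filter (λ q → proj₂ q ≟ v) l)) (labelled-∷ʳ ps p) ⟩
    map proj₁ (filter (λ q → proj₂ q ≟ v) (labelled ps ∷ʳ (2 + length ps , p)))
  ≡⟨ cong (map proj₁) (filter-++ new? (labelled ps) _) ⟩
    map proj₁ (filter new? (labelled ps) ++ filter new? ((2 + length ps , p) ∷ []))
  ≡⟨ map-++ proj₁ (filter new? (labelled ps)) _ ⟩
    children ps v ++ map proj₁ (filter (λ q → proj₂ q ≟ v) ((2 + length ps , p) ∷ [])) ∎
  where
  open ≡-Reasoning
  new? : (q : ℕ × ℕ) → Dec (proj₂ q ≡ v)
  new? q = proj₂ q ≟ v

children-∷ʳ-self : ∀ ps p → children (ps ∷ʳ p) p ≡ children ps p ∷ʳ (2 + length ps)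
children-∷ʳ-self ps p =
  trans (children-∷ʳ ps p p) (cong (λ l → children ps p ++ map proj₁ l) (filter-accept (λ q → proj₂ q ≟ p) refl))

children-∷ʳ-other : ∀ ps {p v} → p ≢ v → children (ps ∷ʳ p) v ≡ children ps v
children-∷ʳ-other ps {p} {v} p≢v = begin
    children (ps ∷ʳ p) v
  ≡⟨ children-∷ʳ ps p v ⟩
    children ps v ++ map proj₁ (filter (λ q → proj₂ q ≟ v) ((2 + length ps , p) ∷ []))
  ≡⟨ cong (λ l → children ps v ++ map proj₁ l) (filter-reject (λ q → proj₂ q ≟ v) p≢v) ⟩
    children ps v ++ []
  ≡⟨ ++-identityʳ (children ps v) ⟩
    children ps v ∎
  where open ≡-Reasoning

pom-∷ʳ : ∀ ps p → pom (ps ∷ʳ p) ≡ p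
pom-∷ʳ ps p = foldl-∷ʳ (λ _ x → x) 0 p ps

nChildren-∷ʳ : ∀ ps p v → nChildren (ps ∷ʳ p) v ≡ ⟦ p ≟ v ⟧ + nChildren ps v
nChildren-∷ʳ ps p v with p ≟ v
... | yes refl = trans (cong length (children-∷ʳ-self ps p)) (length-∷ʳ (children ps p) _)
... | no p≢v   = cong length (children-∷ʳ-other ps p≢v)

nChildren-∷ʳ-self : ∀ ps p → nChildren (ps ∷ʳ p) p ≡ suc (nChildren ps p)
nChildren-∷ʳ-self ps p = trans (nChildren-∷ʳ ps p p) (cong (_+ nChildren ps p) (⟦⟧-yes (p ≟ p) refl))

nChildren-∷ʳ-other : ∀ ps {p v} → p ≢ v → nChildren (ps ∷ʳ p) v ≡ nChildren ps v
nChildren-∷ʳ-other ps {p} {v} p≢v = trans (nChildren-∷ʳ ps p v) (cong (_+ nChildren ps v) (⟦⟧-no (p ≟ v) p≢v))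

data Valid : ℕ → List ℕ → Set where
  empty  : Valid 0 []
  attach : ∀ {L ps p} → Valid L ps → 1 ≤ p → p ≤ suc L → Valid (suc L) (ps ∷ʳ p)

Valid-length : ∀ {L ps} → Valid L ps → length ps ≡ L
Valid-length empty                        = refl
Valid-length (attach {ps = ps} {p} w _ _) = trans (length-∷ʳ ps p) (cong suc (Valid-length w))

children-range : ∀ {L ps} → Valid L ps → ∀ v → All (λ c → v < c × c ≤ suc L) (children ps v)
children-range empty v = []
children-range (attach {L} {ps} {p} w _ p≤) v with p ≟ v
... | yes refl = subst (All _) (sym (children-∷ʳ-self ps p))
  (∷ʳ⁺ (All.map (λ (p<c , c≤) → p<c , m≤n⇒m≤1+n c≤) (children-range w p)) newChild)
  where
  newChild : p < 2 + length ps × 2 + length ps ≤ suc (suc L)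
  newChild rewrite Valid-length w = s≤s p≤ , ≤-refl
... | no p≢v = subst (All _) (sym (children-∷ʳ-other ps p≢v))
  (All.map (λ (v<c , c≤) → v<c , m≤n⇒m≤1+n c≤) (children-range w v))

children-from-last : ∀ {L ps} → Valid L ps → ∀ {v} → suc L ≤ v → children ps v ≡ []
children-from-last {L} {ps} w {v} last≤v with children ps v | children-range w v
... | []    | _               = refl
... | _ ∷ _ | (v<c , c≤) ∷ _ = ⊥-elim (<⇒≱ v<c (≤-trans c≤ last≤v))

nChildren-from-last : ∀ {L ps} → Valid L ps → ∀ {v} → suc L ≤ v → nChildren ps v ≡ 0
nChildren-from-last w last≤v = cong length (children-from-last w last≤v)

-- The minimal chain under attachment.

-- where the chain ends after attaching the vertex `new` below p, if it
-- ended at w before: it moves on to `new` exactly when it ended at p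
moved : ℕ → ℕ → ℕ → ℕ
moved p new w with w ≟ p
... | yes _ = new
... | no  _ = w

moved-here : ∀ {p new w} → w ≡ p → moved p new w ≡ new
moved-here {p} {new} {w} w≡p with w ≟ p
... | yes _   = refl
... | no w≢p = ⊥-elim (w≢p w≡p)

moved-off : ∀ {p new w} → w ≢ p → moved p new w ≡ w
moved-off {p} {new} {w} w≢p with w ≟ p
... | yes w≡p = ⊥-elim (w≢p w≡p)
... | no _    = refl

walk-leaf : ∀ ps f {v} → children ps v ≡ [] → walk ps f v ≡ v
walk-leaf ps zero    eq = refl
walk-leaf ps (suc f) eq rewrite eq = refl

walk-step : ∀ ps f {v c cs} → children ps v ≡ c ∷ cs → walk ps (suc f) v ≡ walk ps f (foldr _⊓_ c cs)
walk-step ps f eq rewrite eq = refl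

smallest : ∀ {P : ℕ → Set} {c cs} → All P (c ∷ cs) → P (foldr _⊓_ c cs)
smallest {P} (pc ∷ pcs) = foldr-preservesᵇ min-preserves pc pcs
  where
  min-preserves : ∀ {x y} → P x → P y → P (x ⊓ y)
  min-preserves {x} {y} px py = [ (λ e → subst P (sym e) px) , (λ e → subst P (sym e) py) ]′ (⊓-sel x y)

-- attaching never changes the smallest child of a vertex that already has
-- one, since the new child carries the largest label
smallest-∷ʳ : ∀ {L ps} → Valid L ps → ∀ p v {c cs} → children ps v ≡ c ∷ cs →
  Σ (List ℕ) λ cs′ → children (ps ∷ʳ p) v ≡ c ∷ cs′ × foldr _⊓_ c cs′ ≡ foldr _⊓_ c cs
smallest-∷ʳ {L} {ps} w p v {c} {cs} eq with p ≟ v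
... | no p≢v   = cs , trans (children-∷ʳ-other ps p≢v) eq , refl
... | yes refl = cs ∷ʳ new , trans (children-∷ʳ-self ps p) (cong (_∷ʳ new) eq) , smaller
  where
  new = 2 + length ps
  c≤new : c ≤ new
  c≤new with children-range w p
  ... | range rewrite eq = ≤-trans (proj₂ (All.head range)) (≤-trans (n≤1+n (suc L)) (≤-reflexive (cong (2 +_) (sym (Valid-length w)))))
  smaller : foldr _⊓_ c (cs ∷ʳ new) ≡ foldr _⊓_ c cs
  smaller = trans (foldr-∷ʳ _⊓_ c new cs) (cong (λ x → foldr _⊓_ x cs) (m≥n⇒m⊓n≡n c≤new))

walk-∷ʳ-leaf : ∀ {L ps} → Valid L ps → ∀ {p} → 1 ≤ p → p ≤ suc L → ∀ f {v} → children ps v ≡ [] →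
  walk (ps ∷ʳ p) (suc f) v ≡ moved p (2 + L) v
walk-∷ʳ-leaf {L} {ps} w {p} 1≤p p≤ f {v} eq with v ≟ p
... | no v≢p = walk-leaf (ps ∷ʳ p) (suc f) (trans (children-∷ʳ-other ps (≢-sym v≢p)) eq)
... | yes refl = begin
    walk (ps ∷ʳ p) (suc f) p
  ≡⟨ walk-step (ps ∷ʳ p) f (trans (children-∷ʳ-self ps p) (cong (_∷ʳ (2 + length ps)) eq)) ⟩
    walk (ps ∷ʳ p) f (2 + length ps)
  ≡⟨ walk-leaf (ps ∷ʳ p) f (children-from-last (attach w 1≤p p≤) (≤-reflexive (cong (2 +_) (sym (Valid-length w))))) ⟩
    2 + length ps
  ≡⟨ cong (2 +_) (Valid-length w) ⟩
    2 + L ∎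
  where open ≡-Reasoning

walk-∷ʳ : ∀ {L ps} → Valid L ps → ∀ {p} → 1 ≤ p → p ≤ suc L → ∀ f v → suc L ≤ f + v →
  walk (ps ∷ʳ p) (suc f) v ≡ moved p (2 + L) (walk ps f v)
walk-∷ʳ w 1≤p p≤ zero v fuel = walk-∷ʳ-leaf w 1≤p p≤ zero (children-from-last w fuel)
walk-∷ʳ {L} {ps} w {p} 1≤p p≤ (suc f) v fuel = by-children (children ps v) refl
  where
  open ≡-Reasoning
  by-children : ∀ cs → children ps v ≡ cs → walk (ps ∷ʳ p) (suc (suc f)) v ≡ moved p (2 + L) (walk ps (suc f) v)
  by-children [] eq = begin
      walk (ps ∷ʳ p) (suc (suc f)) v
    ≡⟨ walk-∷ʳ-leaf w 1≤p p≤ (suc f) eq ⟩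
      moved p (2 + L) v
    ≡⟨ cong (moved p (2 + L)) (sym (walk-leaf ps (suc f) eq)) ⟩
      moved p (2 + L) (walk ps (suc f) v) ∎
  by-children (c ∷ cs) eq with smallest-∷ʳ w p v eq
  ... | cs′ , eq′ , same-min = begin
      walk (ps ∷ʳ p) (suc (suc f)) v
    ≡⟨ walk-step (ps ∷ʳ p) (suc f) eq′ ⟩
      walk (ps ∷ʳ p) (suc f) (foldr _⊓_ c cs′)
    ≡⟨ cong (walk (ps ∷ʳ p) (suc f)) same-min ⟩
      walk (ps ∷ʳ p) (suc f) m
    ≡⟨ walk-∷ʳ w 1≤p p≤ f m fuel′ ⟩
      moved p (2 + L) (walk ps f m)
    ≡⟨ cong (moved p (2 + L)) (sym (walk-step ps f eq)) ⟩
      moved p (2 + L) (walk ps (suc f) v) ∎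
    where
    m = foldr _⊓_ c cs
    v<m : v < m
    v<m = proj₁ (smallest (subst (All _) eq (children-range w v)))
    fuel′ : suc L ≤ f + m
    fuel′ = ≤-trans fuel (≤-trans (≤-reflexive (sym (+-suc f v))) (+-monoʳ-≤ f v<m))

eoc-∷ʳ : ∀ {L ps} → Valid L ps → ∀ {p} → 1 ≤ p → p ≤ suc L → eoc (ps ∷ʳ p) ≡ moved p (2 + L) (eoc ps)
eoc-∷ʳ {L} {ps} w {p} 1≤p p≤ = begin
    walk (ps ∷ʳ p) (suc (length (ps ∷ʳ p))) 1
  ≡⟨ cong (λ l → walk (ps ∷ʳ p) (suc l) 1) (trans (length-∷ʳ ps p) (cong suc (Valid-length w))) ⟩
    walk (ps ∷ʳ p) (suc (suc L)) 1
  ≡⟨ walk-∷ʳ w 1≤p p≤ (suc L) 1 (m≤m+n (suc L) 1) ⟩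
    moved p (2 + L) (walk ps (suc L) 1)
  ≡⟨ cong (λ l → moved p (2 + L) (walk ps (suc l) 1)) (sym (Valid-length w)) ⟩
    moved p (2 + L) (eoc ps) ∎
  where open ≡-Reasoning

eoc-∷ʳ-end : ∀ {L ps} → Valid L ps → ∀ {p} → 1 ≤ p → p ≤ suc L → eoc ps ≡ p → eoc (ps ∷ʳ p) ≡ 2 + L
eoc-∷ʳ-end w 1≤p p≤ e = trans (eoc-∷ʳ w 1≤p p≤) (moved-here e)

eoc-∷ʳ-off : ∀ {L ps} → Valid L ps → ∀ {p} → 1 ≤ p → p ≤ suc L → eoc ps ≢ p → eoc (ps ∷ʳ p) ≡ eoc ps
eoc-∷ʳ-off w 1≤p p≤ e = trans (eoc-∷ʳ w 1≤p p≤) (moved-off e)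

eoc-range : ∀ {L ps} → Valid L ps → 1 ≤ eoc ps × eoc ps ≤ suc L
eoc-range empty = ≤-refl , ≤-refl
eoc-range (attach {L} {ps} {p} w 1≤p p≤) with eoc ps ≟ p
... | yes e = subst (λ x → 1 ≤ x × x ≤ suc (suc L)) (sym (eoc-∷ʳ-end w 1≤p p≤ e)) (s≤s z≤n , ≤-refl)
... | no e  = subst (λ x → 1 ≤ x × x ≤ suc (suc L)) (sym (eoc-∷ʳ-off w 1≤p p≤ e))
  (proj₁ (eoc-range w) , m≤n⇒m≤1+n (proj₂ (eoc-range w)))

eoc-leaf : ∀ {L ps} → Valid L ps → nChildren ps (eoc ps) ≡ 0
eoc-leaf empty = refl
eoc-leaf (attach {L} {ps} {p} w 1≤p p≤) with eoc ps ≟ p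
... | yes e = subst (λ x → nChildren (ps ∷ʳ p) x ≡ 0) (sym (eoc-∷ʳ-end w 1≤p p≤ e))
  (nChildren-from-last (attach w 1≤p p≤) ≤-refl)
... | no e  = subst (λ x → nChildren (ps ∷ʳ p) x ≡ 0) (sym (eoc-∷ʳ-off w 1≤p p≤ e))
  (trans (nChildren-∷ʳ-other ps (≢-sym e)) (eoc-leaf w))

eoc-∷ʳ-old : ∀ {L ps} → Valid L ps → ∀ {p} → 1 ≤ p → p ≤ suc L → eoc (ps ∷ʳ p) ≤ suc L → eoc (ps ∷ʳ p) ≡ eoc ps
eoc-∷ʳ-old {L} {ps} w {p} 1≤p p≤ old with eoc ps ≟ p
... | yes e = ⊥-elim (1+n≰n (subst (_≤ suc L) (eoc-∷ʳ-end w 1≤p p≤ e) old))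
... | no e  = eoc-∷ʳ-off w 1≤p p≤ e

eoc-∷ʳ-fresh : ∀ {L ps} → Valid L ps → ∀ {p} → 1 ≤ p → p ≤ suc L → eoc (ps ∷ʳ p) ≡ 2 + L → eoc ps ≡ p
eoc-∷ʳ-fresh {L} {ps} w {p} 1≤p p≤ new with eoc ps ≟ p
... | yes e = e
... | no e  = ⊥-elim (1+n≰n (subst (_≤ suc L) (trans (sym (eoc-∷ʳ-off w 1≤p p≤ e)) new) (proj₂ (eoc-range w))))

eoc-cherry-end : ∀ {j qs} → Valid j qs → ∀ {x} → 1 ≤ x → x ≤ suc j → eoc qs ≡ x → eoc (qs ∷ʳ x ∷ʳ x) ≡ 2 + j
eoc-cherry-end {j} {qs} w {x} 1≤x x≤ e = trans (eoc-∷ʳ-off (attach w 1≤x x≤) 1≤x (m≤n⇒m≤1+n x≤) end≢x) end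
  where
  end = eoc-∷ʳ-end w 1≤x x≤ e
  end≢x : eoc (qs ∷ʳ x) ≢ x
  end≢x e′ = 1+n≰n (subst (_≤ suc j) (trans (sym e′) end) x≤)

eoc-cherry-off : ∀ {j qs} → Valid j qs → ∀ {x} → 1 ≤ x → x ≤ suc j → eoc qs ≢ x → eoc (qs ∷ʳ x ∷ʳ x) ≡ eoc qs
eoc-cherry-off w 1≤x x≤ e = trans (eoc-∷ʳ-off (attach w 1≤x x≤) 1≤x (m≤n⇒m≤1+n x≤) (λ e′ → e (trans (sym off) e′))) off
  where off = eoc-∷ʳ-off w 1≤x x≤ e

vertices-all : ∀ {P : ℕ → Set} K → (∀ v → 1 ≤ v → v ≤ K → P v) → All P (vertices K)
vertices-all K h = map⁺ (applyUpTo⁺₁ (λ x → x) K (λ {i} i<K → h (suc i) (s≤s z≤n) i<K))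

vertices-lookup : ∀ {P : ℕ → Set} K → All P (vertices K) → ∀ {v} → 1 ≤ v → v ≤ K → P v
vertices-lookup K all {suc i} _ v≤K = applyUpTo⁻ (λ x → x) K (map⁻ all) v≤K

LeafOrFork : ℕ → Set
LeafOrFork d = d ≡ 0 ⊎ d ≡ 2

-- binarity at every positive label; a record rather than a function type,
-- so that ps can be inferred from a proof of Binary ps
record Binary (ps : List ℕ) : Set where
  constructor binary
  field arity : ∀ v → 1 ≤ v → LeafOrFork (nChildren ps v)
open Binary

-- IsBinary checks only the vertices 1,…,1+L, but the others are leaves anyway
IsBinary→Binary : ∀ {L ps} → Valid L ps → IsBinary (suc L) ps → Binary ps
IsBinary→Binary {L} {ps} w bin = binary arity′
  where
  arity′ : ∀ v → 1 ≤ v → LeafOrFork (nChildren ps v)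
  arity′ v 1≤v with v ≤? suc L
  ... | yes v≤ = vertices-lookup (suc L) bin 1≤v v≤
  ... | no v≰  = inj₁ (nChildren-from-last w (<⇒≤ (≰⇒> v≰)))

Binary→IsBinary : ∀ {L ps} → Binary ps → IsBinary (suc L) ps
Binary→IsBinary {L} bin = vertices-all (suc L) (λ v 1≤v _ → arity bin v 1≤v)

¬LeafOrFork-1 : ¬ LeafOrFork 1
¬LeafOrFork-1 (inj₁ ())
¬LeafOrFork-1 (inj₂ ())

¬LeafOrFork-3 : ¬ LeafOrFork 3
¬LeafOrFork-3 (inj₁ ())
¬LeafOrFork-3 (inj₂ ())

single-child : ∀ {ps v} → Binary ps → 1 ≤ v → nChildren ps v ≢ 1
single-child bin 1≤v one = ¬LeafOrFork-1 (subst LeafOrFork one (arity bin _ 1≤v))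

LeafOrFork-2+ : ∀ d → LeafOrFork (2 + d) → d ≡ 0
LeafOrFork-2+ d (inj₂ two) = suc-injective (suc-injective two)

binary-cherry : ∀ {t t′} ℓ → nChildren t′ ℓ ≡ 0 → nChildren t ℓ ≡ 2 →
  (∀ v → v ≢ ℓ → nChildren t v ≡ nChildren t′ v) → (Binary t → Binary t′) × (Binary t′ → Binary t)
binary-cherry {t} {t′} ℓ leaf fork same = to , from
  where
  to : Binary t → Binary t′
  to bin = binary λ v 1≤v → case v ≟ ℓ of λ where
    (yes refl) → inj₁ leaf
    (no v≢ℓ)   → subst LeafOrFork (same v v≢ℓ) (arity bin v 1≤v)
  from : Binary t′ → Binary t
  from bin = binary λ v 1≤v → case v ≟ ℓ of λ where
    (yes refl) → inj₂ fork
    (no v≢ℓ)   → subst LeafOrFork (sym (same v v≢ℓ)) (arity bin v 1≤v)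

-- the penultimate vertex 1+L is never the parent of the last vertex: it
-- would have a single child
pom-not-penultimate : ∀ {L s b} → Valid L s → Binary (s ∷ʳ b) → b ≢ suc L
pom-not-penultimate {L} {s} w bin refl =
  single-child bin (s≤s z≤n) (trans (nChildren-∷ʳ-self s (suc L)) (cong suc (nChildren-from-last w ≤-refl)))

penultimate-fork : ∀ {j qs a} → Valid j qs → Binary (qs ∷ʳ a ∷ʳ suc j) → a ≡ suc j
penultimate-fork {j} {qs} {a} w bin with a ≟ suc j
... | yes a≡ = a≡
... | no a≢  = ⊥-elim (single-child bin (s≤s z≤n) (begin
    nChildren (qs ∷ʳ a ∷ʳ suc j) (suc j) ≡⟨ nChildren-∷ʳ-self (qs ∷ʳ a) (suc j) ⟩
    suc (nChildren (qs ∷ʳ a) (suc j))   ≡⟨ cong suc (nChildren-∷ʳ-other qs a≢) ⟩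
    suc (nChildren qs (suc j))          ≡⟨ cong suc (nChildren-from-last w ≤-refl) ⟩
    1                                   ∎))
  where open ≡-Reasoning

-- in a binary tree on at least two vertices the chain never ends at the last
-- vertex: its parent would have a single child
eoc-not-last : ∀ {i qs} → Valid (suc i) qs → Binary qs → eoc qs ≢ 2 + i
eoc-not-last (attach {ps = rs} {p = c} w 1≤c c≤) bin e = single-child bin 1≤c
  (trans (nChildren-∷ʳ-self rs c) (cong suc (subst (λ x → nChildren rs x ≡ 0) (eoc-∷ʳ-fresh w 1≤c c≤ e) (eoc-leaf w))))

cherry-leaf : ∀ {qs x} → 1 ≤ x → Binary (qs ∷ʳ x ∷ʳ x) → nChildren qs x ≡ 0
cherry-leaf {qs} {x} 1≤x bin = LeafOrFork-2+ _
  (subst LeafOrFork (trans (nChildren-∷ʳ-self (qs ∷ʳ x) x) (cong suc (nChildren-∷ʳ-self qs x))) (arity bin x 1≤x))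

binary-∷ʳ-cherry : ∀ {qs x} → nChildren qs x ≡ 0 →
  (Binary (qs ∷ʳ x ∷ʳ x) → Binary qs) × (Binary qs → Binary (qs ∷ʳ x ∷ʳ x))
binary-∷ʳ-cherry {qs} {x} leaf = binary-cherry x leaf fork same
  where
  fork : nChildren (qs ∷ʳ x ∷ʳ x) x ≡ 2
  fork = trans (nChildren-∷ʳ-self (qs ∷ʳ x) x) (cong suc (trans (nChildren-∷ʳ-self qs x) (cong suc leaf)))
  same : ∀ v → v ≢ x → nChildren (qs ∷ʳ x ∷ʳ x) v ≡ nChildren qs v
  same v v≢x = trans (nChildren-∷ʳ-other (qs ∷ʳ x) (≢-sym v≢x)) (nChildren-∷ʳ-other qs (≢-sym v≢x))

eoc-below-pom-penultimate : ∀ {i qs a b} → Valid (suc i) qs → 1 ≤ a → a ≤ 2 + i →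
  Binary (qs ∷ʳ a ∷ʳ b) → pom (qs ∷ʳ a ∷ʳ b) ≡ 2 + i → eoc (qs ∷ʳ a ∷ʳ b) ≤ suc i
eoc-below-pom-penultimate {i} {qs} {a} {b} w 1≤a a≤ bin pom≡ with trans (sym (pom-∷ʳ (qs ∷ʳ a) b)) pom≡
... | refl with penultimate-fork w bin
...   | refl = subst (_≤ suc i) (sym (eoc-cherry-off w 1≤a a≤ not-last))
  (≤-pred (≤∧≢⇒< (proj₂ (eoc-range w)) not-last))
  where
  not-last : eoc qs ≢ 2 + i
  not-last = eoc-not-last w (proj₁ (binary-∷ʳ-cherry (cherry-leaf 1≤a bin)) bin)

eoc-at-penultimate : ∀ {j qs a b} → Valid j qs → 1 ≤ a → a ≤ suc j → 1 ≤ b → b ≤ 2 + j →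
  eoc (qs ∷ʳ a ∷ʳ b) ≡ 2 + j → eoc qs ≡ a
eoc-at-penultimate w 1≤a a≤ 1≤b b≤ e =
  eoc-∷ʳ-fresh w 1≤a a≤ (trans (sym (eoc-∷ʳ-old (attach w 1≤a a≤) 1≤b b≤ (≤-reflexive e))) e)

-- Finite sums.

∑ : ∀ {A : Set} → List A → (A → ℕ) → ℕ
∑ []       f = 0
∑ (x ∷ xs) f = f x + ∑ xs f

syntax ∑ xs (λ x → e) = ∑[ x ∈ xs ] e

∑-++ : ∀ {A : Set} (xs ys : List A) (f : A → ℕ) → ∑ (xs ++ ys) f ≡ ∑ xs f + ∑ ys f
∑-++ []       ys f = refl
∑-++ (x ∷ xs) ys f = trans (cong (f x +_) (∑-++ xs ys f)) (sym (+-assoc (f x) _ _))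

∑-map : ∀ {A B : Set} (h : A → B) (xs : List A) (f : B → ℕ) → ∑ (map h xs) f ≡ ∑[ x ∈ xs ] f (h x)
∑-map h []       f = refl
∑-map h (x ∷ xs) f = cong (f (h x) +_) (∑-map h xs f)

∑-concatMap : ∀ {A B : Set} (h : A → List B) (xs : List A) (f : B → ℕ) →
  ∑ (concatMap h xs) f ≡ ∑[ x ∈ xs ] ∑ (h x) f
∑-concatMap h []       f = refl
∑-concatMap h (x ∷ xs) f = trans (∑-++ (h x) (concatMap h xs) f) (cong (∑ (h x) f +_) (∑-concatMap h xs f))

∑-cong : ∀ {A : Set} {xs : List A} {f g : A → ℕ} → All (λ x → f x ≡ g x) xs → ∑ xs f ≡ ∑ xs g
∑-cong []         = refl
∑-cong (eq ∷ eqs) = cong₂ _+_ eq (∑-cong eqs)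

∑-zero : ∀ {A : Set} {xs : List A} {f : A → ℕ} → All (λ x → f x ≡ 0) xs → ∑ xs f ≡ 0
∑-zero []         = refl
∑-zero (eq ∷ eqs) = cong₂ _+_ eq (∑-zero eqs)

∑-+ : ∀ {A : Set} (xs : List A) (f g : A → ℕ) → ∑[ x ∈ xs ] (f x + g x) ≡ ∑ xs f + ∑ xs g
∑-+ []       f g = refl
∑-+ (x ∷ xs) f g = trans (cong (f x + g x +_) (∑-+ xs f g)) (interchange (f x) (g x) (∑ xs f) (∑ xs g))

∑-vertices-∷ʳ : ∀ K (f : ℕ → ℕ) → ∑ (vertices (suc K)) f ≡ ∑ (vertices K) f + f (suc K)
∑-vertices-∷ʳ K f = begin
    ∑ (map suc (upTo (suc K))) f
  ≡⟨ cong (λ l → ∑ (map suc l) f) (sym (upTo-∷ʳ K)) ⟩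
    ∑ (map suc (upTo K ∷ʳ K)) f
  ≡⟨ cong (λ l → ∑ l f) (map-++ suc (upTo K) (K ∷ [])) ⟩
    ∑ (vertices K ∷ʳ suc K) f
  ≡⟨ ∑-++ (vertices K) (suc K ∷ []) f ⟩
    ∑ (vertices K) f + (f (suc K) + 0)
  ≡⟨ cong (∑ (vertices K) f +_) (+-identityʳ (f (suc K))) ⟩
    ∑ (vertices K) f + f (suc K) ∎
  where open ≡-Reasoning

∑-vertices-cong : ∀ K {f g : ℕ → ℕ} → (∀ v → 1 ≤ v → v ≤ K → f v ≡ g v) → ∑ (vertices K) f ≡ ∑ (vertices K) g
∑-vertices-cong K h = ∑-cong (vertices-all K h)

∑-vertices-single : ∀ K {f : ℕ → ℕ} e → 1 ≤ e → e ≤ K → (∀ v → 1 ≤ v → v ≤ K → v ≢ e → f v ≡ 0) →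
  ∑ (vertices K) f ≡ f e
∑-vertices-single zero    e 1≤e e≤0 _ = ⊥-elim (1+n≰n (≤-trans 1≤e e≤0))
∑-vertices-single (suc K) {f} e 1≤e e≤ vanish with e ≟ suc K
... | yes refl = trans (∑-vertices-∷ʳ K f)
  (cong (_+ f e) (∑-zero (vertices-all K (λ v 1≤v v≤K → vanish v 1≤v (m≤n⇒m≤1+n v≤K) (<⇒≢ (s≤s v≤K))))))
... | no e≢ = trans (∑-vertices-∷ʳ K f) (trans
  (cong₂ _+_ (∑-vertices-single K e 1≤e (≤-pred (≤∧≢⇒< e≤ e≢)) (λ v 1≤v v≤K → vanish v 1≤v (m≤n⇒m≤1+n v≤K)))
             (vanish (suc K) (s≤s z≤n) ≤-refl (≢-sym e≢)))
  (+-identityʳ (f e)))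

∑-parentLists-suc : ∀ j (F : List ℕ → ℕ) →
  ∑ (parentLists (suc j)) F ≡ ∑[ s ∈ parentLists j ] ∑[ p ∈ vertices (suc j) ] F (s ∷ʳ p)
∑-parentLists-suc j F = trans (∑-concatMap _ (parentLists j) F)
  (∑-cong (All.universal (λ s → ∑-map (s ∷ʳ_) (vertices (suc j)) F) (parentLists j)))

-- every parent list is valid, so sums over them only see valid lists
∑-parentLists-cong : ∀ K {f g : List ℕ → ℕ} → (∀ t → Valid K t → f t ≡ g t) →
  ∑ (parentLists K) f ≡ ∑ (parentLists K) g
∑-parentLists-cong zero    h = cong (_+ 0) (h [] empty)
∑-parentLists-cong (suc K) {f} {g} h = begin
    ∑ (parentLists (suc K)) f
  ≡⟨ ∑-parentLists-suc K f ⟩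
    ∑[ s ∈ parentLists K ] ∑[ p ∈ vertices (suc K) ] f (s ∷ʳ p)
  ≡⟨ ∑-parentLists-cong K (λ s w → ∑-vertices-cong (suc K) (λ p 1≤p p≤ → h (s ∷ʳ p) (attach w 1≤p p≤))) ⟩
    ∑[ s ∈ parentLists K ] ∑[ p ∈ vertices (suc K) ] g (s ∷ʳ p)
  ≡⟨ sym (∑-parentLists-suc K g) ⟩
    ∑ (parentLists (suc K)) g ∎
  where open ≡-Reasoning

∑-parentLists-zero : ∀ K {f : List ℕ → ℕ} → (∀ t → Valid K t → f t ≡ 0) → ∑ (parentLists K) f ≡ 0
∑-parentLists-zero K h = trans (∑-parentLists-cong K h) (∑-zero (All.universal (λ _ → refl) (parentLists K)))

∑-pin-last : ∀ j (F : List ℕ → ℕ) (y : List ℕ → ℕ) → (∀ s → Valid j s → 1 ≤ y s × y s ≤ suc j) →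
  (∀ s p → Valid j s → 1 ≤ p → p ≤ suc j → p ≢ y s → F (s ∷ʳ p) ≡ 0) →
  ∑ (parentLists (suc j)) F ≡ ∑[ s ∈ parentLists j ] F (s ∷ʳ y s)
∑-pin-last j F y y-range vanish = trans (∑-parentLists-suc j F) (∑-parentLists-cong j (λ s w →
  ∑-vertices-single (suc j) (y s) (proj₁ (y-range s w)) (proj₂ (y-range s w)) (λ p 1≤p p≤ → vanish s p w 1≤p p≤)))

-- Counting binary trees.

binaryWith : ∀ L {Q : List ℕ → Set} → (∀ t → Dec (Q t)) → List ℕ → ℕ
binaryWith L Q? t = ⟦ isBinary? (suc L) t ×-dec Q? t ⟧

#trees : ∀ L {Q : List ℕ → Set} → (∀ t → Dec (Q t)) → ℕ
#trees L Q? = ∑[ t ∈ parentLists L ] binaryWith L Q? t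

length-filter² : ∀ {A : Set} {P Q : A → Set} (P? : ∀ x → Dec (P x)) (Q? : ∀ x → Dec (Q x)) xs →
  length (filter Q? (filter P? xs)) ≡ ∑[ x ∈ xs ] ⟦ P? x ×-dec Q? x ⟧
length-filter² P? Q? [] = refl
length-filter² P? Q? (x ∷ xs) with P? x
... | no _  = length-filter² P? Q? xs
... | yes _ with Q? x
...   | yes _ = cong suc (length-filter² P? Q? xs)
...   | no _  = length-filter² P? Q? xs

#trees-filter : ∀ L {Q : List ℕ → Set} (Q? : ∀ t → Dec (Q t)) → length (filter Q? (trees (suc L))) ≡ #trees L Q?
#trees-filter L Q? = length-filter² (isBinary? (suc L)) Q? (parentLists L)

binaryWith-cong : ∀ {L L′ t t′} {Q Q′ : List ℕ → Set} (Q? : ∀ t → Dec (Q t)) (Q′? : ∀ t → Dec (Q′ t)) →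
  Valid L t → Valid L′ t′ → (Binary t × Q t → Binary t′ × Q′ t′) → (Binary t′ × Q′ t′ → Binary t × Q t) →
  binaryWith L Q? t ≡ binaryWith L′ Q′? t′
binaryWith-cong Q? Q′? w w′ to from = ⟦⟧-cong _ _
  (λ (bin , q) → let (bin′ , q′) = to (IsBinary→Binary w bin , q) in Binary→IsBinary bin′ , q′)
  (λ (bin′ , q′) → let (bin , q) = from (IsBinary→Binary w′ bin′ , q′) in Binary→IsBinary bin , q)

binaryWith-no : ∀ {L t} {Q : List ℕ → Set} (Q? : ∀ t → Dec (Q t)) → Valid L t → (Binary t → Q t → ⊥) →
  binaryWith L Q? t ≡ 0
binaryWith-no Q? w never = ⟦⟧-no _ (λ (bin , q) → never (IsBinary→Binary w bin) q)

eocIs : ∀ m t → Dec (eoc t ≡ m)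
eocIs m t = eoc t ≟ m

pomIs : ∀ k t → Dec (pom t ≡ k)
pomIs k t = pom t ≟ k

eocPomIs : ∀ m k t → Dec (eoc t ≡ m × pom t ≡ k)
eocPomIs m k t = eocIs m t ×-dec pomIs k t

-- pom is the last parent, so a condition on pom pins the last entry
pinned-by-pom : ∀ j {Q : List ℕ → Set} (Q? : ∀ t → Dec (Q t)) k → (∀ {t} → Q t → pom t ≡ k) →
  ∀ s p → Valid j s → 1 ≤ p → p ≤ suc j → p ≢ k → binaryWith (suc j) Q? (s ∷ʳ p) ≡ 0
pinned-by-pom j Q? k pom≡ s p w 1≤p p≤ p≢k =
  binaryWith-no Q? (attach w 1≤p p≤) (λ _ q → p≢k (trans (sym (pom-∷ʳ s p)) (pom≡ q)))

#trees-pom : ∀ j {Q : List ℕ → Set} (Q? : ∀ t → Dec (Q t)) k → 1 ≤ k → k ≤ suc j → (∀ {t} → Q t → pom t ≡ k) →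
  #trees (suc j) Q? ≡ ∑[ s ∈ parentLists j ] binaryWith (suc j) Q? (s ∷ʳ k)
#trees-pom j Q? k 1≤k k≤ pom≡ = ∑-pin-last j _ (λ _ → k) (λ _ _ → 1≤k , k≤) (pinned-by-pom j Q? k pom≡)

-- The identities.  Below, a tree of 𝔗_{2n+1} has 3+j vertices, j = 2n-2.

-- g_n(m,2n) = 0: the parent of the last vertex is never the one before it
no-pom-penultimate : ∀ L m → #trees (suc L) (eocPomIs m (suc L)) ≡ 0
no-pom-penultimate L m = ∑-parentLists-zero (suc L) λ where
  _ (attach {ps = s} {p = b} w 1≤b b≤) → binaryWith-no (eocPomIs m (suc L)) (attach w 1≤b b≤)
    λ bin (_ , pom≡) → pom-not-penultimate w bin (trans (sym (pom-∷ʳ s b)) pom≡)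

-- g_n(m,2n-1) = 0 for m ∈ {2n-1, 2n}, where 1+i = 2n-2: the last two
-- vertices form a cherry below 2n-1, which keeps the chain below 2n-1
no-pom-penultimate-eoc-high : ∀ i m → suc i < m → #trees (2 + suc i) (eocPomIs m (2 + i)) ≡ 0
no-pom-penultimate-eoc-high i m i<m = ∑-parentLists-zero (2 + suc i) λ where
  _ (attach (attach w 1≤a a≤) 1≤b b≤) → binaryWith-no (eocPomIs m (2 + i)) (attach (attach w 1≤a a≤) 1≤b b≤)
    λ bin (eoc≡ , pom≡) → <⇒≱ i<m (subst (_≤ suc i) eoc≡ (eoc-below-pom-penultimate w 1≤a a≤ bin pom≡))

-- g_n(m,2n-1) = g_{n-1}(m,•) for m ≤ 2n-2: the last two vertices form a
-- cherry below vertex 2n-1, which leaves the chain where it was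
count-pom-penultimate : ∀ j m → m ≤ j → #trees (2 + j) (eocPomIs m (suc j)) ≡ #trees j (eocIs m)
count-pom-penultimate j m m≤j = begin
    #trees (2 + j) P?
  ≡⟨ #trees-pom (suc j) P? x (s≤s z≤n) (n≤1+n _) proj₂ ⟩
    ∑[ s ∈ parentLists (suc j) ] binaryWith (2 + j) P? (s ∷ʳ x)
  ≡⟨ ∑-pin-last j _ (λ _ → x) (λ _ _ → s≤s z≤n , ≤-refl) fork-vanish ⟩
    ∑[ qs ∈ parentLists j ] binaryWith (2 + j) P? (qs ∷ʳ x ∷ʳ x)
  ≡⟨ ∑-parentLists-cong j cherry ⟩
    #trees j (eocIs m) ∎
  where
  open ≡-Reasoning
  x = suc j
  P? : ∀ t → Dec (eoc t ≡ m × pom t ≡ x)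
  P? = eocPomIs m x
  m≢x : m ≢ x
  m≢x = <⇒≢ (s≤s m≤j)
  fork-vanish : ∀ qs a → Valid j qs → 1 ≤ a → a ≤ suc j → a ≢ x →
    binaryWith (2 + j) P? (qs ∷ʳ a ∷ʳ x) ≡ 0
  fork-vanish qs a w 1≤a a≤ a≢x = binaryWith-no P? (attach (attach w 1≤a a≤) (s≤s z≤n) (n≤1+n _))
    λ bin _ → a≢x (penultimate-fork w bin)
  cherry : ∀ qs → Valid j qs → binaryWith (2 + j) P? (qs ∷ʳ x ∷ʳ x) ≡ binaryWith j (eocIs m) qs
  cherry qs w = binaryWith-cong P? (eocIs m) (attach (attach w (s≤s z≤n) ≤-refl) (s≤s z≤n) (n≤1+n _)) w
    (λ (bin , eoc≡ , _) → proj₁ (binary-∷ʳ-cherry leaf) bin , old-end eoc≡)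
    (λ (bin , eoc≡) → proj₂ (binary-∷ʳ-cherry leaf) bin
                    , trans (eoc-cherry-off w (s≤s z≤n) ≤-refl (λ e → m≢x (trans (sym eoc≡) e))) eoc≡
                    , pom-∷ʳ (qs ∷ʳ x) x)
    where
    leaf : nChildren qs x ≡ 0
    leaf = nChildren-from-last w ≤-refl
    old-end : eoc (qs ∷ʳ x ∷ʳ x) ≡ m → eoc qs ≡ m
    old-end eoc≡ with eoc qs ≟ x
    ... | yes e = ⊥-elim (<⇒≢ (s≤s (m≤n⇒m≤1+n m≤j)) (trans (sym eoc≡) (eoc-cherry-end w (s≤s z≤n) ≤-refl e)))
    ... | no e  = trans (sym (eoc-cherry-off w (s≤s z≤n) ≤-refl e)) eoc≡

-- g_n(2n,k) = g_{n-1}(k,•) for 1 ≤ k ≤ 2n-2: the last two vertices form a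
-- cherry below k, which was the end of the chain
count-eoc-penultimate : ∀ j k → 1 ≤ k → k ≤ j → #trees (2 + j) (eocPomIs (2 + j) k) ≡ #trees j (eocIs k)
count-eoc-penultimate j k 1≤k k≤j = begin
    #trees (2 + j) P?
  ≡⟨ #trees-pom (suc j) P? k 1≤k (m≤n⇒m≤1+n k≤1+j) proj₂ ⟩
    ∑[ s ∈ parentLists (suc j) ] binaryWith (2 + j) P? (s ∷ʳ k)
  ≡⟨ ∑-pin-last j _ (λ _ → k) (λ _ _ → 1≤k , k≤1+j) chain-vanish ⟩
    ∑[ qs ∈ parentLists j ] binaryWith (2 + j) P? (qs ∷ʳ k ∷ʳ k)
  ≡⟨ ∑-parentLists-cong j cherry ⟩
    #trees j (eocIs k) ∎
  where
  open ≡-Reasoning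
  P? : ∀ t → Dec (eoc t ≡ 2 + j × pom t ≡ k)
  P? = eocPomIs (2 + j) k
  k≤1+j : k ≤ suc j
  k≤1+j = m≤n⇒m≤1+n k≤j
  k≤2+j : k ≤ 2 + j
  k≤2+j = m≤n⇒m≤1+n k≤1+j
  -- the chain can only reach 2+j if that vertex hangs below the old end a,
  -- and then a must also carry the last vertex
  chain-vanish : ∀ qs a → Valid j qs → 1 ≤ a → a ≤ suc j → a ≢ k → binaryWith (2 + j) P? (qs ∷ʳ a ∷ʳ k) ≡ 0
  chain-vanish qs a w 1≤a a≤ a≢k = binaryWith-no P? (attach (attach w 1≤a a≤) 1≤k k≤2+j) λ bin (eoc≡ , _) →
    let end = eoc-at-penultimate w 1≤a a≤ 1≤k k≤2+j eoc≡ in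
    single-child bin 1≤a (begin
      nChildren (qs ∷ʳ a ∷ʳ k) a ≡⟨ nChildren-∷ʳ-other (qs ∷ʳ a) (≢-sym a≢k) ⟩
      nChildren (qs ∷ʳ a) a     ≡⟨ nChildren-∷ʳ-self qs a ⟩
      suc (nChildren qs a)      ≡⟨ cong (λ v → suc (nChildren qs v)) (sym end) ⟩
      suc (nChildren qs (eoc qs)) ≡⟨ cong suc (eoc-leaf w) ⟩
      1                         ∎)
  cherry : ∀ qs → Valid j qs → binaryWith (2 + j) P? (qs ∷ʳ k ∷ʳ k) ≡ binaryWith j (eocIs k) qs
  cherry qs w = binaryWith-cong P? (eocIs k) (attach (attach w 1≤k k≤1+j) 1≤k k≤2+j) w
    (λ (bin , eoc≡ , _) → proj₁ (binary-∷ʳ-cherry (cherry-leaf 1≤k bin)) bin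
                        , eoc-at-penultimate w 1≤k k≤1+j 1≤k k≤2+j eoc≡)
    (λ (bin , eoc≡) → proj₂ (binary-∷ʳ-cherry (subst (λ v → nChildren qs v ≡ 0) eoc≡ (eoc-leaf w))) bin
                    , eoc-cherry-end w 1≤k k≤1+j eoc≡
                    , pom-∷ʳ (qs ∷ʳ k) k)

-- g_n(2n-1,k) = g_{n-1}(k,•) + g_{n-1}(•,k) for 1 ≤ k ≤ 2n-2.  Write a tree
-- of 𝔗_{2n+1} as rs ∷ʳ c ∷ʳ a ∷ʳ k, where rs has 1+i = 2n-2 vertices and
-- 2+i = 2n-1 hangs below c.  The chain ends at 2n-1 iff c is the end e of
-- the chain of rs and a ≠ 2n-1.  Binarity forces a cherry below the leaf e:
-- either its second leaf is 2n+1 (e = k), and removing the cherry leaves a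
-- tree on 2n-1 vertices with chain ending at k; or it is 2n (a = e), and
-- removing it leaves a tree on 2n-1 vertices with pom = k.
module EocAntepenultimate (i k : ℕ) (1≤k : 1 ≤ k) (k≤ : k ≤ suc i) where

  P? : ∀ t → Dec (eoc t ≡ 2 + i × pom t ≡ k)
  P? = eocPomIs (2 + i) k

  F E Pm : List ℕ → ℕ
  F  = binaryWith (3 + i) P?
  E  = binaryWith (suc i) (eocIs k)
  Pm = binaryWith (suc i) (pomIs k)

  k≤3+i : k ≤ 3 + i
  k≤3+i = m≤n⇒m≤1+n (m≤n⇒m≤1+n k≤)

  valid : ∀ {rs c a} → Valid i rs → 1 ≤ c → c ≤ suc i → 1 ≤ a → a ≤ 2 + i → Valid (3 + i) (rs ∷ʳ c ∷ʳ a ∷ʳ k)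
  valid w 1≤c c≤ 1≤a a≤ = attach (attach (attach w 1≤c c≤) 1≤a a≤) 1≤k k≤3+i

  eoc-at-2+i : ∀ {rs c a} → Valid i rs → 1 ≤ c → c ≤ suc i → 1 ≤ a → a ≤ 2 + i →
    eoc (rs ∷ʳ c ∷ʳ a ∷ʳ k) ≡ 2 + i → eoc rs ≡ c × a ≢ 2 + i
  eoc-at-2+i {rs} {c} {a} w 1≤c c≤ 1≤a a≤ e = eoc-∷ʳ-fresh w 1≤c c≤ e₁ , a≢
    where
    e₂ : eoc (rs ∷ʳ c ∷ʳ a) ≡ 2 + i
    e₂ = trans (sym (eoc-∷ʳ-old (attach (attach w 1≤c c≤) 1≤a a≤) 1≤k k≤3+i (m≤n⇒m≤1+n (≤-reflexive e)))) e
    e₁ : eoc (rs ∷ʳ c) ≡ 2 + i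
    e₁ = trans (sym (eoc-∷ʳ-old (attach w 1≤c c≤) 1≤a a≤ (≤-reflexive e₂))) e₂
    a≢ : a ≢ 2 + i
    a≢ a≡ = 1+n≢n (trans (sym (eoc-∷ʳ-end (attach w 1≤c c≤) 1≤a a≤ (trans e₁ (sym a≡)))) e₂)

  eoc-stays-at-2+i : ∀ {rs c a} → Valid i rs → 1 ≤ c → c ≤ suc i → 1 ≤ a → a ≤ suc i →
    eoc rs ≡ c → eoc (rs ∷ʳ c ∷ʳ a ∷ʳ k) ≡ 2 + i
  eoc-stays-at-2+i {rs} {c} {a} w 1≤c c≤ 1≤a a≤ end =
    trans (eoc-∷ʳ-off (attach (attach w 1≤c c≤) 1≤a (m≤n⇒m≤1+n a≤)) 1≤k k≤3+i (λ e → <⇒≢ (s≤s k≤) (trans (sym e) e₂))) e₂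
    where
    e₁ : eoc (rs ∷ʳ c) ≡ 2 + i
    e₁ = eoc-∷ʳ-end w 1≤c c≤ end
    e₂ : eoc (rs ∷ʳ c ∷ʳ a) ≡ 2 + i
    e₂ = trans (eoc-∷ʳ-off (attach w 1≤c c≤) 1≤a (m≤n⇒m≤1+n a≤) (λ e → <⇒≢ (s≤s a≤) (trans (sym e) e₁))) e₁

  chain-vanish : ∀ rs c → Valid i rs → 1 ≤ c → c ≤ suc i → c ≢ eoc rs →
    ∑[ a ∈ vertices (2 + i) ] F (rs ∷ʳ c ∷ʳ a ∷ʳ k) ≡ 0
  chain-vanish rs c w 1≤c c≤ c≢ = ∑-zero (vertices-all (2 + i) vanish)
    where
    vanish : ∀ a → 1 ≤ a → a ≤ 2 + i → F (rs ∷ʳ c ∷ʳ a ∷ʳ k) ≡ 0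
    vanish a 1≤a a≤ = binaryWith-no P? (valid w 1≤c c≤ 1≤a a≤)
      λ _ (eoc≡ , _) → c≢ (sym (proj₁ (eoc-at-2+i w 1≤c c≤ 1≤a a≤ eoc≡)))

  -- Case e = k: the cherry below k consists of 2n-1 and 2n+1.
  module AtK {rs} (w : Valid i rs) (end : eoc rs ≡ k) where

    leaf : nChildren rs k ≡ 0
    leaf = subst (λ v → nChildren rs v ≡ 0) end (eoc-leaf w)

    cherry : ∀ {d} → d ≢ k → (Binary (rs ∷ʳ k ∷ʳ d ∷ʳ k) → Binary (rs ∷ʳ d)) × (Binary (rs ∷ʳ d) → Binary (rs ∷ʳ k ∷ʳ d ∷ʳ k))
    cherry {d} d≢k = binary-cherry k (trans (nChildren-∷ʳ-other rs d≢k) leaf) fork same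
      where
      open ≡-Reasoning
      fork : nChildren (rs ∷ʳ k ∷ʳ d ∷ʳ k) k ≡ 2
      fork = begin
        nChildren (rs ∷ʳ k ∷ʳ d ∷ʳ k) k ≡⟨ nChildren-∷ʳ-self (rs ∷ʳ k ∷ʳ d) k ⟩
        suc (nChildren (rs ∷ʳ k ∷ʳ d) k) ≡⟨ cong suc (nChildren-∷ʳ-other (rs ∷ʳ k) d≢k) ⟩
        suc (nChildren (rs ∷ʳ k) k)      ≡⟨ cong suc (nChildren-∷ʳ-self rs k) ⟩
        2 + nChildren rs k               ≡⟨ cong (2 +_) leaf ⟩
        2                                ∎
      same : ∀ v → v ≢ k → nChildren (rs ∷ʳ k ∷ʳ d ∷ʳ k) v ≡ nChildren (rs ∷ʳ d) v
      same v v≢k = begin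
        nChildren (rs ∷ʳ k ∷ʳ d ∷ʳ k) v    ≡⟨ nChildren-∷ʳ-other (rs ∷ʳ k ∷ʳ d) (≢-sym v≢k) ⟩
        nChildren (rs ∷ʳ k ∷ʳ d) v         ≡⟨ nChildren-∷ʳ (rs ∷ʳ k) d v ⟩
        ⟦ d ≟ v ⟧ + nChildren (rs ∷ʳ k) v  ≡⟨ cong (⟦ d ≟ v ⟧ +_) (nChildren-∷ʳ-other rs (≢-sym v≢k)) ⟩
        ⟦ d ≟ v ⟧ + nChildren rs v         ≡⟨ sym (nChildren-∷ʳ rs d v) ⟩
        nChildren (rs ∷ʳ d) v              ∎

    remove-cherry : ∀ d → 1 ≤ d → d ≤ suc i → F (rs ∷ʳ k ∷ʳ d ∷ʳ k) ≡ E (rs ∷ʳ d)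
    remove-cherry d 1≤d d≤ = binaryWith-cong P? (eocIs k) (valid w 1≤k k≤ 1≤d (m≤n⇒m≤1+n d≤)) (attach w 1≤d d≤)
      (λ (bin , _) → let d≢k = not-three bin in
        proj₁ (cherry d≢k) bin , trans (eoc-∷ʳ-off w 1≤d d≤ (λ e → d≢k (trans (sym e) end))) end)
      (λ (bin , eoc≡) → let d≢k = not-end eoc≡ in
        proj₂ (cherry d≢k) bin , eoc-stays-at-2+i w 1≤k k≤ 1≤d d≤ end , pom-∷ʳ (rs ∷ʳ k ∷ʳ d) k)
      where
      -- k cannot carry three children
      not-three : Binary (rs ∷ʳ k ∷ʳ d ∷ʳ k) → d ≢ k
      not-three bin refl = ¬LeafOrFork-3 (subst LeafOrFork three (arity bin k 1≤k))
        where
        three : nChildren (rs ∷ʳ k ∷ʳ k ∷ʳ k) k ≡ 3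
        three = trans (nChildren-∷ʳ-self (rs ∷ʳ k ∷ʳ k) k) (cong suc (trans (nChildren-∷ʳ-self (rs ∷ʳ k) k)
                  (cong suc (trans (nChildren-∷ʳ-self rs k) (cong suc leaf)))))
      -- hanging d below the end k would move the chain past k
      not-end : eoc (rs ∷ʳ d) ≡ k → d ≢ k
      not-end eoc≡ refl = <⇒≢ (s≤s k≤) (trans (sym eoc≡) (eoc-∷ʳ-end w 1≤d d≤ end))

    -- 2n below the new leaf 2n-1 would move the chain
    last-vanish : F (rs ∷ʳ k ∷ʳ (2 + i) ∷ʳ k) ≡ 0
    last-vanish = binaryWith-no P? (valid w 1≤k k≤ (s≤s z≤n) ≤-refl)
      λ _ (eoc≡ , _) → proj₂ (eoc-at-2+i w 1≤k k≤ (s≤s z≤n) ≤-refl eoc≡) refl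

    -- the leaf k cannot be the parent of the last vertex
    pom-vanish : ∀ d → 1 ≤ d → d ≤ suc i → Pm (rs ∷ʳ d) ≡ 0
    pom-vanish d 1≤d d≤ = binaryWith-no (pomIs k) (attach w 1≤d d≤) λ bin pom≡ →
      let d≡k = trans (sym (pom-∷ʳ rs d)) pom≡ in
      single-child bin 1≤d (trans (nChildren-∷ʳ-self rs d) (cong suc (subst (λ v → nChildren rs v ≡ 0) (sym d≡k) leaf)))

    per-root : ∑[ a ∈ vertices (2 + i) ] F (rs ∷ʳ eoc rs ∷ʳ a ∷ʳ k)
             ≡ ∑[ d ∈ vertices (suc i) ] E (rs ∷ʳ d) + ∑[ d ∈ vertices (suc i) ] Pm (rs ∷ʳ d)
    per-root = begin
        ∑[ a ∈ vertices (2 + i) ] F (rs ∷ʳ eoc rs ∷ʳ a ∷ʳ k)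
      ≡⟨ cong (λ c → ∑[ a ∈ vertices (2 + i) ] F (rs ∷ʳ c ∷ʳ a ∷ʳ k)) end ⟩
        ∑[ a ∈ vertices (2 + i) ] F (rs ∷ʳ k ∷ʳ a ∷ʳ k)
      ≡⟨ ∑-vertices-∷ʳ (suc i) (λ a → F (rs ∷ʳ k ∷ʳ a ∷ʳ k)) ⟩
        ∑[ d ∈ vertices (suc i) ] F (rs ∷ʳ k ∷ʳ d ∷ʳ k) + F (rs ∷ʳ k ∷ʳ (2 + i) ∷ʳ k)
      ≡⟨ cong₂ _+_ (∑-vertices-cong (suc i) remove-cherry) last-vanish ⟩
        ∑[ d ∈ vertices (suc i) ] E (rs ∷ʳ d) + 0
      ≡⟨ cong (∑[ d ∈ vertices (suc i) ] E (rs ∷ʳ d) +_) (sym (∑-zero (vertices-all (suc i) pom-vanish))) ⟩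
        ∑[ d ∈ vertices (suc i) ] E (rs ∷ʳ d) + ∑[ d ∈ vertices (suc i) ] Pm (rs ∷ʳ d) ∎
      where open ≡-Reasoning

  -- Case e ≠ k: the cherry below e consists of 2n-1 and 2n.
  module OffK {rs} (w : Valid i rs) (e≢k : eoc rs ≢ k) where

    e = eoc rs

    1≤e : 1 ≤ e
    1≤e = proj₁ (eoc-range w)

    e≤ : e ≤ suc i
    e≤ = proj₂ (eoc-range w)

    leaf : nChildren rs e ≡ 0
    leaf = eoc-leaf w

    k≢e : k ≢ e
    k≢e = ≢-sym e≢k

    -- 2n must hang below e as well, or e has a single child
    fork-vanish : ∀ a → 1 ≤ a → a ≤ 2 + i → a ≢ e → F (rs ∷ʳ e ∷ʳ a ∷ʳ k) ≡ 0
    fork-vanish a 1≤a a≤ a≢e = binaryWith-no P? (valid w 1≤e e≤ 1≤a a≤) λ bin _ → single-child bin 1≤e (begin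
        nChildren (rs ∷ʳ e ∷ʳ a ∷ʳ k) e ≡⟨ nChildren-∷ʳ-other (rs ∷ʳ e ∷ʳ a) k≢e ⟩
        nChildren (rs ∷ʳ e ∷ʳ a) e      ≡⟨ nChildren-∷ʳ-other (rs ∷ʳ e) a≢e ⟩
        nChildren (rs ∷ʳ e) e           ≡⟨ nChildren-∷ʳ-self rs e ⟩
        suc (nChildren rs e)            ≡⟨ cong suc leaf ⟩
        1                               ∎)
      where open ≡-Reasoning

    remove-cherry : F (rs ∷ʳ e ∷ʳ e ∷ʳ k) ≡ Pm (rs ∷ʳ k)
    remove-cherry = binaryWith-cong P? (pomIs k) (valid w 1≤e e≤ 1≤e (m≤n⇒m≤1+n e≤)) (attach w 1≤k k≤)
      (λ (bin , _) → proj₁ cherry bin , pom-∷ʳ rs k)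
      (λ (bin , _) → proj₂ cherry bin , eoc-stays-at-2+i w 1≤e e≤ 1≤e e≤ refl , pom-∷ʳ (rs ∷ʳ e ∷ʳ e) k)
      where
      open ≡-Reasoning
      cherry : (Binary (rs ∷ʳ e ∷ʳ e ∷ʳ k) → Binary (rs ∷ʳ k)) × (Binary (rs ∷ʳ k) → Binary (rs ∷ʳ e ∷ʳ e ∷ʳ k))
      cherry = binary-cherry e (trans (nChildren-∷ʳ-other rs k≢e) leaf) fork same
        where
        fork : nChildren (rs ∷ʳ e ∷ʳ e ∷ʳ k) e ≡ 2
        fork = trans (nChildren-∷ʳ-other (rs ∷ʳ e ∷ʳ e) k≢e)
          (trans (nChildren-∷ʳ-self (rs ∷ʳ e) e) (cong suc (trans (nChildren-∷ʳ-self rs e) (cong suc leaf))))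
        same : ∀ v → v ≢ e → nChildren (rs ∷ʳ e ∷ʳ e ∷ʳ k) v ≡ nChildren (rs ∷ʳ k) v
        same v v≢e = begin
          nChildren (rs ∷ʳ e ∷ʳ e ∷ʳ k) v    ≡⟨ nChildren-∷ʳ (rs ∷ʳ e ∷ʳ e) k v ⟩
          ⟦ k ≟ v ⟧ + nChildren (rs ∷ʳ e ∷ʳ e) v
            ≡⟨ cong (⟦ k ≟ v ⟧ +_) (trans (nChildren-∷ʳ-other (rs ∷ʳ e) (≢-sym v≢e)) (nChildren-∷ʳ-other rs (≢-sym v≢e))) ⟩
          ⟦ k ≟ v ⟧ + nChildren rs v         ≡⟨ sym (nChildren-∷ʳ rs k v) ⟩
          nChildren (rs ∷ʳ k) v              ∎

    -- a tree rs ∷ʳ d has its chain ending at e or at 2+i, never at k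
    eoc-vanish : ∀ d → 1 ≤ d → d ≤ suc i → E (rs ∷ʳ d) ≡ 0
    eoc-vanish d 1≤d d≤ = binaryWith-no (eocIs k) (attach w 1≤d d≤) λ _ eoc≡ →
      e≢k (trans (sym (eoc-∷ʳ-old w 1≤d d≤ (subst (_≤ suc i) (sym eoc≡) k≤))) eoc≡)

    per-root : ∑[ a ∈ vertices (2 + i) ] F (rs ∷ʳ eoc rs ∷ʳ a ∷ʳ k)
             ≡ ∑[ d ∈ vertices (suc i) ] E (rs ∷ʳ d) + ∑[ d ∈ vertices (suc i) ] Pm (rs ∷ʳ d)
    per-root = begin
        ∑[ a ∈ vertices (2 + i) ] F (rs ∷ʳ e ∷ʳ a ∷ʳ k)
      ≡⟨ ∑-vertices-single (2 + i) e 1≤e (m≤n⇒m≤1+n e≤) fork-vanish ⟩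
        F (rs ∷ʳ e ∷ʳ e ∷ʳ k)
      ≡⟨ remove-cherry ⟩
        Pm (rs ∷ʳ k)
      ≡⟨ sym (∑-vertices-single (suc i) k 1≤k k≤ (λ d → pinned-by-pom i (pomIs k) k (λ pom≡ → pom≡) rs d w)) ⟩
        ∑[ d ∈ vertices (suc i) ] Pm (rs ∷ʳ d)
      ≡⟨ cong (_+ ∑[ d ∈ vertices (suc i) ] Pm (rs ∷ʳ d)) (sym (∑-zero (vertices-all (suc i) eoc-vanish))) ⟩
        ∑[ d ∈ vertices (suc i) ] E (rs ∷ʳ d) + ∑[ d ∈ vertices (suc i) ] Pm (rs ∷ʳ d) ∎
      where open ≡-Reasoning

  per-root : ∀ rs → Valid i rs → ∑[ a ∈ vertices (2 + i) ] F (rs ∷ʳ eoc rs ∷ʳ a ∷ʳ k)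
           ≡ ∑[ d ∈ vertices (suc i) ] E (rs ∷ʳ d) + ∑[ d ∈ vertices (suc i) ] Pm (rs ∷ʳ d)
  per-root rs w with eoc rs ≟ k
  ... | yes end = AtK.per-root w end
  ... | no e≢k  = OffK.per-root w e≢k

  count : #trees (3 + i) P? ≡ #trees (suc i) (eocIs k) + #trees (suc i) (pomIs k)
  count = begin
      #trees (3 + i) P?
    ≡⟨ #trees-pom (2 + i) P? k 1≤k k≤3+i proj₂ ⟩
      ∑[ s ∈ parentLists (2 + i) ] F (s ∷ʳ k)
    ≡⟨ ∑-parentLists-suc (suc i) (λ s → F (s ∷ʳ k)) ⟩
      ∑[ u ∈ parentLists (suc i) ] ∑[ a ∈ vertices (2 + i) ] F (u ∷ʳ a ∷ʳ k)
    ≡⟨ ∑-pin-last i _ eoc (λ _ → eoc-range) chain-vanish ⟩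
      ∑[ rs ∈ parentLists i ] ∑[ a ∈ vertices (2 + i) ] F (rs ∷ʳ eoc rs ∷ʳ a ∷ʳ k)
    ≡⟨ ∑-parentLists-cong i per-root ⟩
      ∑[ rs ∈ parentLists i ] (∑[ d ∈ vertices (suc i) ] E (rs ∷ʳ d) + ∑[ d ∈ vertices (suc i) ] Pm (rs ∷ʳ d))
    ≡⟨ ∑-+ (parentLists i) _ _ ⟩
      ∑[ rs ∈ parentLists i ] ∑[ d ∈ vertices (suc i) ] E (rs ∷ʳ d)
        + ∑[ rs ∈ parentLists i ] ∑[ d ∈ vertices (suc i) ] Pm (rs ∷ʳ d)
    ≡⟨ sym (cong₂ _+_ (∑-parentLists-suc i E) (∑-parentLists-suc i Pm)) ⟩
      #trees (suc i) (eocIs k) + #trees (suc i) (pomIs k) ∎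
    where open ≡-Reasoning

-- the statement of the theorem, with N in place of 2n
Theorem-2·1 : ℕ → ℕ → Set
Theorem-2·1 n N =
      ((m : ℕ) → 1 ≤ m → m ≤ N → g n m N ≡ 0)
    × ((m : ℕ) → 1 ≤ m → m ≤ N ∸ 2 → g n m (N ∸ 1) ≡ gEoc (n ∸ 1) m)
    × (g n (N ∸ 1) (N ∸ 1) ≡ 0 × g n N (N ∸ 1) ≡ 0)
    × ((k : ℕ) → 1 ≤ k → k ≤ N ∸ 2 → g n N k ≡ gEoc (n ∸ 1) k)
    × (g n N (N ∸ 1) ≡ 0 × g n N N ≡ 0)
    × ((k : ℕ) → 1 ≤ k → k ≤ N ∸ 2 →
         g n (N ∸ 1) k ≡ gEoc (n ∸ 1) k + gPom (n ∸ 1) k)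
    × (g n (N ∸ 1) (N ∸ 1) ≡ 0 × g n (N ∸ 1) N ≡ 0)

theorem2p1 : (n : ℕ) → 2 ≤ n →
      -- (1)
      ((m : ℕ) → 1 ≤ m → m ≤ 2 * n → g n m (2 * n) ≡ 0)
    × ((m : ℕ) → 1 ≤ m → m ≤ 2 * n ∸ 2 → g n m (2 * n ∸ 1) ≡ gEoc (n ∸ 1) m)
    × (g n (2 * n ∸ 1) (2 * n ∸ 1) ≡ 0 × g n (2 * n) (2 * n ∸ 1) ≡ 0)
      -- (2)
    × ((k : ℕ) → 1 ≤ k → k ≤ 2 * n ∸ 2 → g n (2 * n) k ≡ gEoc (n ∸ 1) k)
    × (g n (2 * n) (2 * n ∸ 1) ≡ 0 × g n (2 * n) (2 * n) ≡ 0)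
    × ((k : ℕ) → 1 ≤ k → k ≤ 2 * n ∸ 2 →
         g n (2 * n ∸ 1) k ≡ gEoc (n ∸ 1) k + gPom (n ∸ 1) k)
    × (g n (2 * n ∸ 1) (2 * n ∸ 1) ≡ 0 × g n (2 * n ∸ 1) (2 * n) ≡ 0)
theorem2p1 (suc zero) (s≤s ())
theorem2p1 (suc (suc n′)) _ = subst (Theorem-2·1 n) (sym 2n≡3+i)
    ( (λ m _ _ → g-2n m)
    , (λ m _ m≤ → trans (g≡ m (2 + i)) (trans (count-pom-penultimate (suc i) m m≤) (sym (gEoc≡ m))))
    , (g-2n-1 (2 + i) ≤-refl , g-2n-1 (3 + i) (n≤1+n _))
    , (λ k 1≤k k≤ → trans (g≡ (3 + i) k) (trans (count-eoc-penultimate (suc i) k 1≤k k≤) (sym (gEoc≡ k))))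
    , (g-2n-1 (3 + i) (n≤1+n _) , g-2n (3 + i))
    , (λ k 1≤k k≤ → trans (g≡ (2 + i) k)
        (trans (EocAntepenultimate.count i k 1≤k k≤) (sym (cong₂ _+_ (gEoc≡ k) (gPom≡ k)))))
    , (g-2n-1 (2 + i) ≤-refl , g-2n (2 + i)) )
  where
  n = suc (suc n′)
  -- trees of 𝔗_{2n+1} have 4+i vertices, those of 𝔗_{2n-1} have 2+i
  i = pred (2 * suc n′)
  2n≡3+i : 2 * n ≡ 3 + i
  2n≡3+i = *-distribˡ-+ 2 1 (suc n′)
  g≡ : ∀ m k → g n m k ≡ #trees (3 + i) (eocPomIs m k)
  g≡ m k = trans (cong (λ N → length (filter (eocPomIs m k) (trees (suc N)))) 2n≡3+i) (#trees-filter (3 + i) (eocPomIs m k))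
  gEoc≡ : ∀ m → gEoc (n ∸ 1) m ≡ #trees (suc i) (eocIs m)
  gEoc≡ m = #trees-filter (suc i) (eocIs m)
  gPom≡ : ∀ k → gPom (n ∸ 1) k ≡ #trees (suc i) (pomIs k)
  gPom≡ k = #trees-filter (suc i) (pomIs k)
  g-2n : ∀ m → g n m (3 + i) ≡ 0
  g-2n m = trans (g≡ m (3 + i)) (no-pom-penultimate (2 + i) m)
  g-2n-1 : ∀ m → suc i < m → g n m (2 + i) ≡ 0
  g-2n-1 m i<m = trans (g≡ m (2 + i)) (no-pom-penultimate-eoc-high i m i<m)
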